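{- Let $X$ be an observational strategy on an arena $A$ and let $S, T \in X$ with $S \subseteq T$. Then $S = T$.
   Context: A set $S$ of well-bracketed O-views (plays equal to their own O-view) over $A$ is O-deterministic if: $u o_1, u o_2 \in S$ with $o_1,o_2$ O-moves implies $o_1 = o_2$; each element of $S$ is single-threaded (exactly one occurrence of an initial move); all non-empty elements begin with the same initial move. An observational strategy on $A$ is a set $X$ of O-deterministic sets over $A$ such that whenever $S, T \in X$ with $S \neq T$, there exist a play $t$ and O-moves $o_1 \neq o_2$ with $t o_1 \in S$ and $t o_2 \in T$. -}

module Defs where

open import Level using (0ℓ)
open import Data.Nat using (ℕ; zero; suc; _<_)
open import Data.List using (List; []; _∷_; _++_; [_]; length; upTo)
open import Data.Maybe using (Maybe; just; nothing)
open import Data.Product using (Σ; ∃; _×_; _,_; proj₁)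
open import Relation.Binary.PropositionalEquality using (_≡_; _≢_)
open import Relation.Nullary using (¬_)
open import Relation.Unary using (Pred; _∈_; _≐_)

data Player : Set where
  O P : Player

data Kind : Set where
  Q A : Kind

record Arena : Set₁ where
  field
    Move  : Set
    pol   : Move → Player
    kind  : Move → Kind
    Init  : Move → Set
    _⊢_   : Move → Move → Set
    init-O : ∀ m → Init m → pol m ≡ O
    init-Q : ∀ m → Init m → kind m ≡ Q
    ⊢-alt  : ∀ m n → m ⊢ n → pol m ≢ pol n
    ⊢-ans  : ∀ m n → m ⊢ n → kind n ≡ A → kind m ≡ Q

-- Justified sequences: a list of moves, each carrying a justification
-- pointer given as the absolute position (0-based) of its justifier,
-- or nothing if it is justified by ⋆.

_!_ : {X : Set} → List X → ℕ → Maybe X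
[]      ! _     = nothing
(x ∷ _) ! zero  = just x
(_ ∷ s) ! suc n = s ! n

module _ (Ar : Arena) where
  open Arena Ar

  Entry : Set
  Entry = Move × Maybe ℕ

  Seq : Set
  Seq = List Entry

  JustPtr : Seq → ℕ → Move → Maybe ℕ → Set
  JustPtr s i m nothing  = Init m
  JustPtr s i m (just j) = j < i × Σ Move λ n → Σ (Maybe ℕ) λ q → (s ! j ≡ just (n , q)) × (n ⊢ m)

  Justified : Seq → Set
  Justified s = ∀ i m p → s ! i ≡ just (m , p) → JustPtr s i m p

  opp : Player → Player
  opp O = P
  opp P = O

  polAt : ℕ → Player
  polAt zero    = O
  polAt (suc i) = opp (polAt i)

  Alternating : Seq → Set
  Alternating s = ∀ i m p → s ! i ≡ just (m , p) → pol m ≡ polAt i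

  IsPlay : Seq → Set
  IsPlay s = Justified s × Alternating s

  IsOMove : Entry → Set
  IsOMove e = pol (proj₁ e) ≡ O

  -- Positions of the prefix of length n of s retained by its O-view:
  --   ⌞ε⌟ = ε ;  ⌞s o⌟ = ⌞s⌟ o  (o an O-move) ;
  --   ⌞s n t p⌟ = ⌞s n⌟ p      (p a P-move justified by n).
  -- The first argument is fuel (length s suffices for plays).
  ovPos : ℕ → Seq → ℕ → List ℕ
  ovPos zero    s n       = []
  ovPos (suc f) s zero    = []
  ovPos (suc f) s (suc n) with s ! n
  ... | nothing = []
  ... | just (m , p) with pol m | p
  ...   | O | _       = ovPos f s n ++ [ n ]
  ...   | P | nothing = ovPos f s n ++ [ n ]
  ...   | P | just j  = ovPos f s (suc j) ++ [ n ]

  OViewPositions : Seq → List ℕ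
  OViewPositions s = ovPos (length s) s (length s)

  -- a play equal to its own O-view (its O-view keeps every position)
  IsOView : Seq → Set
  IsOView s = IsPlay s × OViewPositions s ≡ upTo (length s)

  IsQAt : Seq → ℕ → Set
  IsQAt s q = Σ Entry λ e → (s ! q ≡ just e) × (kind (proj₁ e) ≡ Q)

  AnsweredIn : Seq → ℕ → ℕ → Set
  AnsweredIn s n q = Σ ℕ λ k → q < k × k < n ×
    Σ Move λ m → (s ! k ≡ just (m , just q)) × (kind m ≡ A)

  Pending : Seq → ℕ → ℕ → Set
  Pending s n q = q < n × IsQAt s q × ¬ AnsweredIn s n q ×
    (∀ q' → q < q' → q' < n → IsQAt s q' → AnsweredIn s n q')

  WellBracketed : Seq → Set
  WellBracketed s = ∀ k m j → s ! k ≡ just (m , just j) → kind m ≡ A → Pending s k j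

  IsWBOView : Seq → Set
  IsWBOView s = IsOView s × WellBracketed s

  InitialAt : Seq → ℕ → Set
  InitialAt s i = Σ Entry λ e → (s ! i ≡ just e) × Init (proj₁ e)

  SingleThreaded : Seq → Set
  SingleThreaded s = s ≢ [] →
    Σ ℕ λ i → InitialAt s i × (∀ j → InitialAt s j → j ≡ i)

  record ODeterministic (S : Pred Seq 0ℓ) : Set where
    field
      wbOView  : ∀ s → s ∈ S → IsWBOView s
      det      : ∀ u o₁ o₂ → IsOMove o₁ → IsOMove o₂ →
                 (u ++ [ o₁ ]) ∈ S → (u ++ [ o₂ ]) ∈ S → o₁ ≡ o₂
      single   : ∀ s → s ∈ S → SingleThreaded s
      sameInit : ∀ e₁ s₁ e₂ s₂ → (e₁ ∷ s₁) ∈ S → (e₂ ∷ s₂) ∈ S →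
                 proj₁ e₁ ≡ proj₁ e₂

  record Observational (X : Pred (Pred Seq 0ℓ) 0ℓ) : Set₁ where
    field
      odet  : ∀ S → S ∈ X → ODeterministic S
      apart : ∀ S T → S ∈ X → T ∈ X → ¬ (S ≐ T) →
              Σ Seq λ t → Σ Entry λ o₁ → Σ Entry λ o₂ →
                IsPlay t × IsOMove o₁ × IsOMove o₂ × o₁ ≢ o₂ ×
                (t ++ [ o₁ ]) ∈ S × (t ++ [ o₂ ]) ∈ T

-- If S ⊆ T but S ≠ T, observationality provides a play t and two
-- distinct O-moves o₁ ≢ o₂ with t o₁ ∈ S and t o₂ ∈ T.  Then t o₁ ∈ T as
-- well, so T contains two one-O-move extensions of t, which O-determinism
-- of T forces to coincide: a contradiction.
module Submission where

open import Defs
open import Level using (0ℓ)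
open import Relation.Unary using (Pred; _∈_; _⊆_; _≐_)
open import Axiom.ExcludedMiddle using (ExcludedMiddle)
open import Relation.Nullary using (¬_; yes; no; contradiction)
open import Data.List using ([_]; _++_)
open import Data.Product using (Σ; _×_; _,_)
open import Relation.Binary.PropositionalEquality using (_≢_)

module _ {Ar : Arena} where

  BranchApart : Pred (Seq Ar) 0ℓ → Pred (Seq Ar) 0ℓ → Set
  BranchApart S T = Σ (Seq Ar) λ t → Σ (Entry Ar) λ o₁ → Σ (Entry Ar) λ o₂ →
    IsPlay Ar t × IsOMove Ar o₁ × IsOMove Ar o₂ × o₁ ≢ o₂ ×
    (t ++ [ o₁ ]) ∈ S × (t ++ [ o₂ ]) ∈ T

  subset-not-apart : ∀ {S T} → ODeterministic Ar T → S ⊆ T → ¬ BranchApart S T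
  subset-not-apart detT S⊆T (t , o₁ , o₂ , _ , o₁-O , o₂-O , o₁≢o₂ , to₁∈S , to₂∈T) =
    o₁≢o₂ (ODeterministic.det detT t o₁ o₂ o₁-O o₂-O (S⊆T to₁∈S) to₂∈T)

proposition8 : ExcludedMiddle 0ℓ → (Ar : Arena) → (X : Pred (Pred (Seq Ar) 0ℓ) 0ℓ) →
    Observational Ar X → ∀ S T → S ∈ X → T ∈ X → S ⊆ T → S ≐ T
proposition8 em Ar X obs S T S∈X T∈X S⊆T with em {S ≐ T}
... | yes S≐T = S≐T
... | no S≭T  = contradiction (Observational.apart obs S T S∈X T∈X S≭T)
                              (subset-not-apart (Observational.odet obs T T∈X) S⊆T)
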